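{- Let $R$ be any commutative ring and $\phi=(\phi_{ij})\in X_5(R)$ with $\mathrm{Pf}(\phi)=(p_1,\dots,p_5)$. Let $I$ be the ideal of $R[x_1,\dots,x_5]$ generated by $p_1,\dots,p_5$. Then $$\frac{\partial(p_1,p_2,p_3)}{\partial(x_1,x_2,x_3)}\equiv\phi_{45}\sum_{i,j=1}^5\frac{\partial p_i}{\partial x_1}\frac{\partial\phi_{ij}}{\partial x_2}\frac{\partial p_j}{\partial x_3}\pmod I.$$
   Context: $X_5(R)$ is the set of $5\times5$ alternating matrices whose entries are linear forms in $R[x_1,\dots,x_5]$. $\mathrm{Pf}(\phi)=(p_1,\dots,p_5)$ with $p_i=(-1)^i\,\mathrm{pf}(\phi^{\{i\}})$, where $\phi^{\{i\}}$ is $\phi$ with its $i$th row and column deleted and the Pfaffian of a $4\times4$ alternating matrix $(a_{ij})$ is $a_{12}a_{34}-a_{13}a_{24}+a_{14}a_{23}$. $\partial(p_1,p_2,p_3)/\partial(x_1,x_2,x_3)$ denotes the Jacobian determinant. -}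

module Defs where

open import Level using (_⊔_)
open import Data.Nat using (ℕ; zero; suc)
open import Data.Fin using (Fin; zero; suc; toℕ; punchIn)
open import Data.Product using (Σ)
open import Relation.Nullary using (yes; no)
open import Algebra.Bundles using (CommutativeRing)

-- Polynomials in five variables x₁..x₅ (indexed by Fin 5, index 0 = x₁)
-- over a commutative ring R, presented as the free commutative R-algebra:
-- syntactic terms modulo the congruence generated by the commutative
-- ring axioms and the requirement that constants form a ring
-- homomorphism R → R[x₁,…,x₅].
module Pol {c ℓ} (R : CommutativeRing c ℓ) where
  open CommutativeRing R using (_≈_) renaming (Carrier to A; _+_ to _+ᴿ_; _*_ to _*ᴿ_; -_ to -ᴿ_; 0# to 0ᴿ; 1# to 1ᴿ)

  infixl 6 _⊕_
  infixl 7 _⊗_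
  infix 8 ⊝_
  infix 4 _≋_

  data Poly : Set c where
    con : A → Poly
    var : Fin 5 → Poly
    _⊕_ : Poly → Poly → Poly
    _⊗_ : Poly → Poly → Poly
    ⊝_  : Poly → Poly

  data _≋_ : Poly → Poly → Set (c ⊔ ℓ) where
    ≋-refl  : ∀ {p} → p ≋ p
    ≋-sym   : ∀ {p q} → p ≋ q → q ≋ p
    ≋-trans : ∀ {p q r} → p ≋ q → q ≋ r → p ≋ r
    ⊕-cong  : ∀ {p p' q q'} → p ≋ p' → q ≋ q' → p ⊕ q ≋ p' ⊕ q'
    ⊗-cong  : ∀ {p p' q q'} → p ≋ p' → q ≋ q' → p ⊗ q ≋ p' ⊗ q'
    ⊝-cong  : ∀ {p q} → p ≋ q → ⊝ p ≋ ⊝ q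
    ⊕-assoc : ∀ p q r → (p ⊕ q) ⊕ r ≋ p ⊕ (q ⊕ r)
    ⊕-comm  : ∀ p q → p ⊕ q ≋ q ⊕ p
    ⊕-idˡ   : ∀ p → con 0ᴿ ⊕ p ≋ p
    ⊝-invˡ  : ∀ p → ⊝ p ⊕ p ≋ con 0ᴿ
    ⊗-assoc : ∀ p q r → (p ⊗ q) ⊗ r ≋ p ⊗ (q ⊗ r)
    ⊗-comm  : ∀ p q → p ⊗ q ≋ q ⊗ p
    ⊗-idˡ   : ∀ p → con 1ᴿ ⊗ p ≋ p
    distribˡ : ∀ p q r → p ⊗ (q ⊕ r) ≋ p ⊗ q ⊕ p ⊗ r
    con-cong : ∀ {a b} → a ≈ b → con a ≋ con b
    con-+   : ∀ a b → con (a +ᴿ b) ≋ con a ⊕ con b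
    con-*   : ∀ a b → con (a *ᴿ b) ≋ con a ⊗ con b
    con--   : ∀ a → con (-ᴿ a) ≋ ⊝ con a

  ∂ : Fin 5 → Poly → Poly
  ∂ k (con _) = con 0ᴿ
  ∂ k (var j) with k Data.Fin.≟ j
  ... | yes _ = con 1ᴿ
  ... | no  _ = con 0ᴿ
  ∂ k (p ⊕ q) = ∂ k p ⊕ ∂ k q
  ∂ k (p ⊗ q) = ∂ k p ⊗ q ⊕ p ⊗ ∂ k q
  ∂ k (⊝ p) = ⊝ ∂ k p

  Σᶠ : ∀ {n} → (Fin n → Poly) → Poly
  Σᶠ {zero}  f = con 0ᴿ
  Σᶠ {suc n} f = f zero ⊕ Σᶠ (λ i → f (suc i))

  -- X₅(R): 5×5 alternating matrices of linear forms; entry (i,j) is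
  -- Σ_k coeff i j k · x_k
  record X5 : Set (c ⊔ ℓ) where
    field
      coeff   : Fin 5 → Fin 5 → Fin 5 → A
      alt-diag : ∀ i k → coeff i i k ≈ 0ᴿ
      alt-skew : ∀ i j k → coeff j i k ≈ -ᴿ coeff i j k

  entry : X5 → Fin 5 → Fin 5 → Poly
  entry φ i j = Σᶠ (λ k → con (X5.coeff φ i j k) ⊗ var k)

  pf4 : (Fin 4 → Fin 4 → Poly) → Poly
  pf4 a = a zero (suc zero) ⊗ a (suc (suc zero)) (suc (suc (suc zero)))
        ⊕ ⊝ (a zero (suc (suc zero)) ⊗ a (suc zero) (suc (suc (suc zero))))
        ⊕ a zero (suc (suc (suc zero))) ⊗ a (suc zero) (suc (suc zero))

  sgn : ℕ → Poly → Poly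
  sgn zero    q = q
  sgn (suc n) q = ⊝ sgn n q

  -- p_i = (-1)^i pf(φ^{i}) ; Fin index i corresponds to the paper's i+1
  pfaff : X5 → Fin 5 → Poly
  pfaff φ i = sgn (suc (toℕ i)) (pf4 (λ r s → entry φ (punchIn i r) (punchIn i s)))

  det3 : (Fin 3 → Fin 3 → Poly) → Poly
  det3 m = m0 0' ⊗ (m1 1' ⊗ m2 2' ⊕ ⊝ (m1 2' ⊗ m2 1'))
         ⊕ ⊝ (m0 1' ⊗ (m1 0' ⊗ m2 2' ⊕ ⊝ (m1 2' ⊗ m2 0')))
         ⊕ m0 2' ⊗ (m1 0' ⊗ m2 1' ⊕ ⊝ (m1 1' ⊗ m2 0'))
    where
      0' 1' 2' : Fin 3
      0' = zero
      1' = suc zero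
      2' = suc (suc zero)
      m0 m1 m2 : Fin 3 → Poly
      m0 = m zero
      m1 = m (suc zero)
      m2 = m (suc (suc zero))

  jac123 : X5 → Poly
  jac123 φ = det3 (λ r s → ∂ (emb r) (pfaff φ (emb s)) )
    where
      emb : Fin 3 → Fin 5
      emb zero = zero
      emb (suc zero) = suc zero
      emb (suc (suc zero)) = suc (suc zero)

  rhs : X5 → Poly
  rhs φ = entry φ (suc (suc (suc zero))) (suc (suc (suc (suc zero))))
        ⊗ Σᶠ (λ i → Σᶠ (λ j →
            ∂ zero (pfaff φ i) ⊗ ∂ (suc zero) (entry φ i j) ⊗ ∂ (suc (suc zero)) (pfaff φ j)))

  _≡_mod-Pf_ : Poly → Poly → X5 → Set (c ⊔ ℓ)
  f ≡ g mod-Pf φ = Σ (Fin 5 → Poly) (λ a → f ≋ g ⊕ Σᶠ (λ i → a i ⊗ pfaff φ i))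

{-# OPTIONS --safe #-}
module Submission where

-- Since the entries of φ are linear forms, ∂φ/∂x₁, ∂φ/∂x₂, ∂φ/∂x₃ are constant
-- alternating matrices, and both sides of the congruence, as well as p₁, …, p₅,
-- are polynomials in the entries of φ and of these three matrices.  So it is
-- enough to exhibit cofactors a₁, …, a₅ with  jacobian − rhs = Σ aᵢ pᵢ  for a
-- generic alternating φ and three generic alternating ∂φ/∂x_k, i.e. as an
-- identity over ℤ in 10 + 3·10 indeterminates.  Such cofactors exist with each
-- aᵢ of degree one in φ and trilinear in the three derivative matrices; the
-- identity is verified by normalising it, and then evaluated in R[x₁,…,x₅].

open import Level using (_⊔_) renaming (zero to 0ℓ)
open import Data.Nat as ℕ using (ℕ; zero; suc; _≡ᵇ_)
open import Data.Nat.Properties using (≡ᵇ⇒≡)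
open import Data.Empty using (⊥-elim)
open import Data.Fin as Fin using (Fin; zero; suc; toℕ; punchIn; combine; remQuot; _↑ˡ_)
open import Data.Fin.Properties using (<-cmp; remQuot-combine; suc-injective)
open import Data.List using (List; []; _∷_)
open import Data.Bool using (T)
open import Data.Maybe using (nothing)
open import Data.Product using (_,_; _×_; uncurry)
open import Data.Vec using (Vec; tabulate)
open import Data.Vec.Properties using (lookup∘tabulate)
open import Function using (_∘_)
open import Relation.Binary.Definitions using (tri<; tri≈; tri>)
open import Relation.Nullary using (yes; no)
open import Relation.Binary.PropositionalEquality as ≡ using (_≡_; _≢_)
import Relation.Binary.Reasoning.Setoid as SetoidReasoning
open import Algebra.Bundles using (CommutativeRing; RawRing; Ring)
open import Algebra.Structures using (IsCommutativeRing)
import Algebra.Properties.AbelianGroup as AbelianGroupProperties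
import Algebra.Properties.CommutativeSemigroup as CommutativeSemigroupProperties
import Algebra.Properties.RingWithoutOne as RingWithoutOneProperties
import Algebra.Properties.Semiring.Mult as SemiringMultiplication
open import Tactic.RingSolver.Core.AlmostCommutativeRing using (fromCommutativeRing)
open import Tactic.RingSolver.Core.Polynomial.Parameters using (RawCoeff; Homomorphism)
import Tactic.RingSolver.Core.Polynomial.Base as PolynomialNormalForm
import Tactic.RingSolver.Core.Polynomial.Semantics as NormalFormSemantics
import Tactic.RingSolver.Core.Polynomial.Homomorphism as NormalFormHomomorphism
open import Defs

infixl 6 _+ᵗ_
infixl 7 _*ᵗ_
infix 8 -ᵗ_
infixl 1 _>>=_

data Term (X : Set) : Set where
  atom      : X → Term X
  0ᵗ        : Term X
  _+ᵗ_ _*ᵗ_ : Term X → Term X → Term X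
  -ᵗ_       : Term X → Term X

_>>=_ : ∀ {X Y} → Term X → (X → Term Y) → Term Y
atom x   >>= f = f x
0ᵗ       >>= f = 0ᵗ
(s +ᵗ t) >>= f = (s >>= f) +ᵗ (t >>= f)
(s *ᵗ t) >>= f = (s >>= f) *ᵗ (t >>= f)
(-ᵗ t)   >>= f = -ᵗ (t >>= f)

module Evaluation {c ℓ} (S : CommutativeRing c ℓ) where
  open CommutativeRing S

  ⟦_⟧ : ∀ {X} → Term X → (X → Carrier) → Carrier
  ⟦ atom x ⟧ ρ = ρ x
  ⟦ 0ᵗ ⟧     ρ = 0#
  ⟦ s +ᵗ t ⟧ ρ = ⟦ s ⟧ ρ + ⟦ t ⟧ ρ
  ⟦ s *ᵗ t ⟧ ρ = ⟦ s ⟧ ρ * ⟦ t ⟧ ρ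
  ⟦ -ᵗ t ⟧   ρ = - ⟦ t ⟧ ρ

  ⟦⟧-cong : ∀ {X} {ρ ρ′ : X → Carrier} → (∀ x → ρ x ≈ ρ′ x) → ∀ t → ⟦ t ⟧ ρ ≈ ⟦ t ⟧ ρ′
  ⟦⟧-cong ρ≈ρ′ (atom x) = ρ≈ρ′ x
  ⟦⟧-cong ρ≈ρ′ 0ᵗ       = refl
  ⟦⟧-cong ρ≈ρ′ (s +ᵗ t) = +-cong (⟦⟧-cong ρ≈ρ′ s) (⟦⟧-cong ρ≈ρ′ t)
  ⟦⟧-cong ρ≈ρ′ (s *ᵗ t) = *-cong (⟦⟧-cong ρ≈ρ′ s) (⟦⟧-cong ρ≈ρ′ t)
  ⟦⟧-cong ρ≈ρ′ (-ᵗ t)   = -‿cong (⟦⟧-cong ρ≈ρ′ t)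

  ⟦⟧->>= : ∀ {X Y} (t : Term X) (f : X → Term Y) ρ → ⟦ t >>= f ⟧ ρ ≡ ⟦ t ⟧ (λ x → ⟦ f x ⟧ ρ)
  ⟦⟧->>= (atom x) f ρ = ≡.refl
  ⟦⟧->>= 0ᵗ       f ρ = ≡.refl
  ⟦⟧->>= (s +ᵗ t) f ρ = ≡.cong₂ _+_ (⟦⟧->>= s f ρ) (⟦⟧->>= t f ρ)
  ⟦⟧->>= (s *ᵗ t) f ρ = ≡.cong₂ _*_ (⟦⟧->>= s f ρ) (⟦⟧->>= t f ρ)
  ⟦⟧->>= (-ᵗ t)   f ρ = ≡.cong -_ (⟦⟧->>= t f ρ)

-- (a , b) stands for the integer a − b.  The raw operations need satisfy no laws
-- (two representatives of one integer are different coefficients): the normaliser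
-- only relies on their images in a commutative ring and on isZero being sound.
Difference : Set
Difference = ℕ × ℕ

_+ᵈ_ _*ᵈ_ : Difference → Difference → Difference
(a , b) +ᵈ (c , d) = (a ℕ.+ c , b ℕ.+ d)
(a , b) *ᵈ (c , d) = (a ℕ.* c ℕ.+ b ℕ.* d , a ℕ.* d ℕ.+ b ℕ.* c)

-ᵈ_ : Difference → Difference
-ᵈ (a , b) = (b , a)

differenceCoefficients : RawCoeff 0ℓ 0ℓ
differenceCoefficients = record
  { rawRing = record
    { Carrier = Difference ; _≈_ = _≡_
    ; _+_ = _+ᵈ_ ; _*_ = _*ᵈ_ ; -_ = -ᵈ_ ; 0# = (0 , 0) ; 1# = (1 , 0) }
  ; isZero = uncurry _≡ᵇ_ }

module DifferenceEmbedding {c ℓ} (S : CommutativeRing c ℓ) where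
  open CommutativeRing S
  open SemiringMultiplication semiring using (×-homo-0; ×-homo-1; ×-homo-+; ×1-homo-*) renaming (_×_ to _·_)
  open RingWithoutOneProperties (Ring.ringWithoutOne ring) using (-‿distribˡ-*; x[y-z]≈xy-xz; -0#≈0#)
  open AbelianGroupProperties +-abelianGroup using (⁻¹-anti-homo‿-; ⁻¹-∙-comm)
  open CommutativeSemigroupProperties +-commutativeSemigroup using (interchange)
  open SetoidReasoning setoid

  ⟦_⟧ᵈ : Difference → Carrier
  ⟦ (a , b) ⟧ᵈ = a · 1# - b · 1#

  ⟦⟧ᵈ-+ : ∀ x y → ⟦ x +ᵈ y ⟧ᵈ ≈ ⟦ x ⟧ᵈ + ⟦ y ⟧ᵈ
  ⟦⟧ᵈ-+ (a , b) (c , d) = begin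
    (a ℕ.+ c) · 1# - (b ℕ.+ d) · 1#          ≈⟨ +-cong (×-homo-+ 1# a c) (-‿cong (×-homo-+ 1# b d)) ⟩
    (a · 1# + c · 1#) - (b · 1# + d · 1#)    ≈⟨ +-congˡ (⁻¹-∙-comm _ _) ⟨
    (a · 1# + c · 1#) + (- b · 1# - d · 1#)  ≈⟨ interchange _ _ _ _ ⟩
    (a · 1# - b · 1#) + (c · 1# - d · 1#)    ∎

  difference-* : ∀ x y z w → (x - y) * (z - w) ≈ (x * z + y * w) - (x * w + y * z)
  difference-* x y z w = begin
    (x - y) * (z - w)                          ≈⟨ distribʳ _ _ _ ⟩
    x * (z - w) + - y * (z - w)                ≈⟨ +-congˡ (-‿distribˡ-* _ _) ⟨
    x * (z - w) - y * (z - w)                  ≈⟨ +-cong (x[y-z]≈xy-xz x z w) (-‿cong (x[y-z]≈xy-xz y z w)) ⟩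
    (x * z - x * w) - (y * z - y * w)          ≈⟨ +-congˡ (⁻¹-anti-homo‿- _ _) ⟩
    (x * z - x * w) + (y * w - y * z)          ≈⟨ interchange _ _ _ _ ⟩
    (x * z + y * w) + (- (x * w) + - (y * z))  ≈⟨ +-congˡ (⁻¹-∙-comm _ _) ⟩
    (x * z + y * w) - (x * w + y * z)          ∎

  ⟦⟧ᵈ-* : ∀ x y → ⟦ x *ᵈ y ⟧ᵈ ≈ ⟦ x ⟧ᵈ * ⟦ y ⟧ᵈ
  ⟦⟧ᵈ-* (a , b) (c , d) = begin
    (a ℕ.* c ℕ.+ b ℕ.* d) · 1# - (a ℕ.* d ℕ.+ b ℕ.* c) · 1#
      ≈⟨ +-cong (·1-homo a c b d) (-‿cong (·1-homo a d b c)) ⟩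
    ((a · 1#) * (c · 1#) + (b · 1#) * (d · 1#)) - ((a · 1#) * (d · 1#) + (b · 1#) * (c · 1#))
      ≈⟨ difference-* _ _ _ _ ⟨
    (a · 1# - b · 1#) * (c · 1# - d · 1#) ∎
    where
    ·1-homo : ∀ m n p q → (m ℕ.* n ℕ.+ p ℕ.* q) · 1# ≈ (m · 1#) * (n · 1#) + (p · 1#) * (q · 1#)
    ·1-homo m n p q = trans (×-homo-+ 1# (m ℕ.* n) (p ℕ.* q)) (+-cong (×1-homo-* m n) (×1-homo-* p q))

  ⟦⟧ᵈ-zero : ∀ x → T (RawCoeff.isZero differenceCoefficients x) → 0# ≈ ⟦ x ⟧ᵈ
  ⟦⟧ᵈ-zero (a , b) a≡ᵇb with ≡ᵇ⇒≡ a b a≡ᵇb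
  ... | ≡.refl = sym (-‿inverseʳ _)

  homomorphism : Homomorphism 0ℓ 0ℓ c ℓ
  homomorphism = record
    { from = differenceCoefficients
    ; to = fromCommutativeRing S (λ _ → nothing)
    ; morphism = record
      { ⟦_⟧ = ⟦_⟧ᵈ
      ; +-homo = ⟦⟧ᵈ-+
      ; *-homo = ⟦⟧ᵈ-*
      ; -‿homo = λ { (a , b) → sym (⁻¹-anti-homo‿- _ _) }
      ; 0-homo = -‿inverseʳ _
      ; 1-homo = trans (+-cong (×-homo-1 1#) (-‿cong (×-homo-0 1#))) (trans (+-congˡ -0#≈0#) (+-identityʳ 1#)) }
    ; Zero-C⟶Zero-R = ⟦⟧ᵈ-zero }

module Normalisation where
  open PolynomialNormalForm differenceCoefficients using (Poly; κ; ι; _⊞_; _⊠_; ⊟_)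

  normalForm : ∀ {n} → Term (Fin n) → Poly n
  normalForm (atom i) = ι i
  normalForm 0ᵗ       = κ (0 , 0)
  normalForm (s +ᵗ t) = normalForm s ⊞ normalForm t
  normalForm (s *ᵗ t) = normalForm s ⊠ normalForm t
  normalForm (-ᵗ t)   = ⊟ normalForm t

  module _ {c ℓ} (S : CommutativeRing c ℓ) where
    open CommutativeRing S
    open Evaluation S
    open NormalFormSemantics (DifferenceEmbedding.homomorphism S) renaming (⟦_⟧ to ⟦_⟧ₙ)
    open NormalFormHomomorphism (DifferenceEmbedding.homomorphism S)
    open SetoidReasoning setoid

    normalForm-sound : ∀ {n} (t : Term (Fin n)) ρ → ⟦ normalForm t ⟧ₙ (tabulate ρ) ≈ ⟦ t ⟧ ρ
    normalForm-sound (atom i) ρ = trans (ι-hom i (tabulate ρ)) (reflexive (lookup∘tabulate ρ i))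
    normalForm-sound 0ᵗ       ρ = -‿inverseʳ _
    normalForm-sound (s +ᵗ t) ρ =
      trans (⊞-hom (normalForm s) (normalForm t) (tabulate ρ)) (+-cong (normalForm-sound s ρ) (normalForm-sound t ρ))
    normalForm-sound (s *ᵗ t) ρ =
      trans (⊠-hom (normalForm s) (normalForm t) (tabulate ρ)) (*-cong (normalForm-sound s ρ) (normalForm-sound t ρ))
    normalForm-sound (-ᵗ t)   ρ = trans (⊟-hom (normalForm t) (tabulate ρ)) (-‿cong (normalForm-sound t ρ))

    ≈0-by-normalForm : ∀ {X n} (index : X → Fin n) (unindex : Fin n → X) → (∀ x → unindex (index x) ≡ x) →
                       ∀ t → normalForm (t >>= atom ∘ index) ≡ normalForm 0ᵗ → ∀ ρ → ⟦ t ⟧ ρ ≈ 0#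
    ≈0-by-normalForm {n = n} index unindex retract t nf-zero ρ = begin
      ⟦ t ⟧ ρ                                      ≈⟨ ⟦⟧-cong (λ x → reflexive (≡.cong ρ (retract x))) t ⟨
      ⟦ t ⟧ (ρ ∘ unindex ∘ index)                  ≡⟨ ⟦⟧->>= t _ _ ⟨
      ⟦ t >>= atom ∘ index ⟧ (ρ ∘ unindex)         ≈⟨ normalForm-sound (t >>= atom ∘ index) (ρ ∘ unindex) ⟨
      ⟦ normalForm (t >>= atom ∘ index) ⟧ₙ ρ′      ≡⟨ ≡.cong (λ p → ⟦ p ⟧ₙ ρ′) nf-zero ⟩
      ⟦ normalForm {n} 0ᵗ ⟧ₙ ρ′                    ≈⟨ normalForm-sound 0ᵗ (ρ ∘ unindex) ⟩
      0#                                           ∎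
      where
      ρ′ : Vec Carrier n
      ρ′ = tabulate (ρ ∘ unindex)

module PolynomialRing {c ℓ} (R : CommutativeRing c ℓ) where
  open Pol R
  open CommutativeRing R using (_≈_; -_) renaming (Carrier to Carrierᴿ; 0# to 0ᴿ; 1# to 1ᴿ)

  isCommutativeRing : IsCommutativeRing _≋_ _⊕_ _⊗_ ⊝_ (con 0ᴿ) (con 1ᴿ)
  isCommutativeRing = record
    { isRing = record
      { +-isAbelianGroup = record
        { isGroup = record
          { isMonoid = record
            { isSemigroup = record
              { isMagma = record
                { isEquivalence = record { refl = ≋-refl ; sym = ≋-sym ; trans = ≋-trans }
                ; ∙-cong = ⊕-cong }
              ; assoc = ⊕-assoc }
            ; identity = ⊕-idˡ , λ p → ≋-trans (⊕-comm p _) (⊕-idˡ p) }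
          ; inverse = ⊝-invˡ , λ p → ≋-trans (⊕-comm p _) (⊝-invˡ p)
          ; ⁻¹-cong = ⊝-cong }
        ; comm = ⊕-comm }
      ; *-cong = ⊗-cong
      ; *-assoc = ⊗-assoc
      ; *-identity = ⊗-idˡ , λ p → ≋-trans (⊗-comm p _) (⊗-idˡ p)
      ; distrib = distribˡ , λ p q r →
          ≋-trans (⊗-comm _ p) (≋-trans (distribˡ p q r) (⊕-cong (⊗-comm p q) (⊗-comm p r))) }
    ; *-comm = ⊗-comm }

  commutativeRing : CommutativeRing c (c ⊔ ℓ)
  commutativeRing = record { isCommutativeRing = isCommutativeRing }

  open CommutativeRing commutativeRing using (zeroˡ; zeroʳ; *-identityʳ; +-identityʳ; +-abelianGroup; ring)
  open AbelianGroupProperties +-abelianGroup using (ε⁻¹≈ε; ⁻¹-∙-comm)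
  open RingWithoutOneProperties (Ring.ringWithoutOne ring) using (-‿distribˡ-*)

  Σᶠ-cong : ∀ {n} {f g : Fin n → Poly} → (∀ i → f i ≋ g i) → Σᶠ f ≋ Σᶠ g
  Σᶠ-cong {zero}  f≋g = ≋-refl
  Σᶠ-cong {suc n} f≋g = ⊕-cong (f≋g zero) (Σᶠ-cong (f≋g ∘ suc))

  Σᶠ-⊝ : ∀ {n} (f : Fin n → Poly) → Σᶠ (λ i → ⊝ f i) ≋ ⊝ Σᶠ f
  Σᶠ-⊝ {zero}  f = ≋-sym ε⁻¹≈ε
  Σᶠ-⊝ {suc n} f = ≋-trans (⊕-cong ≋-refl (Σᶠ-⊝ (f ∘ suc))) (⁻¹-∙-comm _ _)

  Σᶠ-0 : ∀ {n} → Σᶠ {n} (λ _ → con 0ᴿ) ≋ con 0ᴿ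
  Σᶠ-0 {zero}  = ≋-refl
  Σᶠ-0 {suc n} = ≋-trans (⊕-idˡ _) (Σᶠ-0 {n})

  Σᶠ-select : ∀ {n} (k : Fin n) (f δ : Fin n → Poly) →
              δ k ≋ con 1ᴿ → (∀ m → k ≢ m → δ m ≋ con 0ᴿ) → Σᶠ (λ m → f m ⊗ δ m) ≋ f k
  Σᶠ-select {suc n} zero f δ δ-on δ-off =
    ≋-trans (⊕-cong (≋-trans (⊗-cong ≋-refl δ-on) (*-identityʳ _)) (≋-trans rest-vanishes Σᶠ-0))
            (+-identityʳ _)
    where
    rest-vanishes : Σᶠ (λ m → f (suc m) ⊗ δ (suc m)) ≋ Σᶠ {n} (λ _ → con 0ᴿ)
    rest-vanishes = Σᶠ-cong λ m → ≋-trans (⊗-cong ≋-refl (δ-off (suc m) λ ())) (zeroʳ _)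
  Σᶠ-select {suc n} (suc k) f δ δ-on δ-off =
    ≋-trans (⊕-cong (≋-trans (⊗-cong ≋-refl (δ-off zero λ ())) (zeroʳ _))
                    (Σᶠ-select k (f ∘ suc) (δ ∘ suc) δ-on λ m k≢m → δ-off (suc m) (k≢m ∘ suc-injective)))
            (⊕-idˡ _)

  ∂-var-self : ∀ k → ∂ k (var k) ≋ con 1ᴿ
  ∂-var-self k with k Fin.≟ k
  ... | yes _  = ≋-refl
  ... | no k≢k = ⊥-elim (k≢k ≡.refl)

  ∂-var-other : ∀ {k m} → k ≢ m → ∂ k (var m) ≋ con 0ᴿ
  ∂-var-other {k} {m} k≢m with k Fin.≟ m
  ... | yes k≡m = ⊥-elim (k≢m k≡m)
  ... | no _    = ≋-refl

  linearForm : (Fin 5 → Carrierᴿ) → Poly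
  linearForm a = Σᶠ (λ m → con (a m) ⊗ var m)

  linearForm-0 : ∀ {a} → (∀ m → a m ≈ 0ᴿ) → linearForm a ≋ con 0ᴿ
  linearForm-0 {a} a≈0 = ≋-trans terms-vanish Σᶠ-0
    where
    terms-vanish : linearForm a ≋ Σᶠ {5} (λ _ → con 0ᴿ)
    terms-vanish = Σᶠ-cong {f = λ m → con (a m) ⊗ var m}
                           λ m → ≋-trans (⊗-cong (con-cong (a≈0 m)) ≋-refl) (zeroˡ _)

  linearForm-neg : ∀ {a b} → (∀ m → b m ≈ - a m) → linearForm b ≋ ⊝ linearForm a
  linearForm-neg {a} {b} b≈-a = ≋-trans terms-negate (Σᶠ-⊝ λ m → con (a m) ⊗ var m)
    where
    terms-negate : linearForm b ≋ Σᶠ (λ m → ⊝ (con (a m) ⊗ var m))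
    terms-negate = Σᶠ-cong {f = λ m → con (b m) ⊗ var m}
                           λ m → ≋-trans (⊗-cong (≋-trans (con-cong (b≈-a m)) (con-- _)) ≋-refl)
                                         (≋-sym (-‿distribˡ-* _ _))

  ∂-linearForm : ∀ k a → ∂ k (linearForm a) ≋ con (a k)
  ∂-linearForm k a = ≋-trans product-rule (Σᶠ-select k (con ∘ a) (λ m → ∂ k (var m)) (∂-var-self k) λ _ → ∂-var-other)
    where
    product-rule : ∂ k (linearForm a) ≋ Σᶠ (λ m → con (a m) ⊗ ∂ k (var m))
    product-rule = Σᶠ-cong {f = λ m → ∂ k (con (a m) ⊗ var m)} λ m → ≋-trans (⊕-cong (zeroˡ _) ≋-refl) (⊕-idˡ _)

pattern 0F = zero
pattern 1F = suc zero
pattern 2F = suc (suc zero)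
pattern 3F = suc (suc (suc zero))
pattern 4F = suc (suc (suc (suc zero)))

-- Φ is φ and ∂Φ k is the constant matrix ∂φ/∂x_{k+1}.
data Matrix : Set where
  Φ  : Matrix
  ∂Φ : Fin 3 → Matrix

infix 9 _[_,_]

record Atom : Set where
  constructor _[_,_]
  field
    matrix  : Matrix
    row col : Fin 5

matrixIndex : Matrix → Fin 4
matrixIndex Φ      = zero
matrixIndex (∂Φ k) = suc k

indexMatrix : Fin 4 → Matrix
indexMatrix zero    = Φ
indexMatrix (suc k) = ∂Φ k

indexMatrix-matrixIndex : ∀ m → indexMatrix (matrixIndex m) ≡ m
indexMatrix-matrixIndex Φ      = ≡.refl
indexMatrix-matrixIndex (∂Φ k) = ≡.refl

atomIndex : Atom → Fin (4 ℕ.* (5 ℕ.* 5))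
atomIndex (m [ i , j ]) = combine (matrixIndex m) (combine i j)

indexAtom : Fin (4 ℕ.* (5 ℕ.* 5)) → Atom
indexAtom = atomAt ∘ remQuot 25
  where
  atomAt : Fin 4 × Fin 25 → Atom
  atomAt (k , ij) = uncurry (indexMatrix k [_,_]) (remQuot 5 ij)

indexAtom-atomIndex : ∀ x → indexAtom (atomIndex x) ≡ x
indexAtom-atomIndex (m [ i , j ]) =
  ≡.trans (≡.cong (λ { (k , ij) → uncurry (indexMatrix k [_,_]) (remQuot 5 ij) })
                  (remQuot-combine (matrixIndex m) (combine i j)))
          (≡.cong₂ (λ m′ → uncurry (m′ [_,_])) (indexMatrix-matrixIndex m) (remQuot-combine i j))

upperTriangular : Atom → Term Atom
upperTriangular (m [ i , j ]) with <-cmp i j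
... | tri< _ _ _ = atom (m [ i , j ])
... | tri≈ _ _ _ = 0ᵗ
... | tri> _ _ _ = -ᵗ atom (m [ j , i ])

module Alternation {c ℓ} (S : CommutativeRing c ℓ) where
  open CommutativeRing S
  open Evaluation S

  record Alternating (ρ : Atom → Carrier) : Set (c ⊔ ℓ) where
    field
      diagonal      : ∀ m i → ρ (m [ i , i ]) ≈ 0#
      antisymmetric : ∀ m i j → ρ (m [ j , i ]) ≈ - ρ (m [ i , j ])

  upperTriangular-sound : ∀ {ρ} → Alternating ρ → ∀ x → ρ x ≈ ⟦ upperTriangular x ⟧ ρ
  upperTriangular-sound alt (m [ i , j ]) with <-cmp i j
  ... | tri< _ _ _      = refl
  ... | tri≈ _ ≡.refl _ = Alternating.diagonal alt m i
  ... | tri> _ _ _      = Alternating.antisymmetric alt m j i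

module _ {X : Set} where
  pf4ᵗ : (Fin 4 → Fin 4 → Term X) → Term X
  pf4ᵗ a = a 0F 1F *ᵗ a 2F 3F +ᵗ -ᵗ (a 0F 2F *ᵗ a 1F 3F) +ᵗ a 0F 3F *ᵗ a 1F 2F

  ∂pf4ᵗ : (a ∂a : Fin 4 → Fin 4 → Term X) → Term X
  ∂pf4ᵗ a ∂a = (∂a 0F 1F *ᵗ a 2F 3F +ᵗ a 0F 1F *ᵗ ∂a 2F 3F)
             +ᵗ -ᵗ (∂a 0F 2F *ᵗ a 1F 3F +ᵗ a 0F 2F *ᵗ ∂a 1F 3F)
             +ᵗ (∂a 0F 3F *ᵗ a 1F 2F +ᵗ a 0F 3F *ᵗ ∂a 1F 2F)

  sgnᵗ : ℕ → Term X → Term X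
  sgnᵗ zero    t = t
  sgnᵗ (suc n) t = -ᵗ sgnᵗ n t

  det3ᵗ : (Fin 3 → Fin 3 → Term X) → Term X
  det3ᵗ m = m 0F 0F *ᵗ (m 1F 1F *ᵗ m 2F 2F +ᵗ -ᵗ (m 1F 2F *ᵗ m 2F 1F))
          +ᵗ -ᵗ (m 0F 1F *ᵗ (m 1F 0F *ᵗ m 2F 2F +ᵗ -ᵗ (m 1F 2F *ᵗ m 2F 0F)))
          +ᵗ m 0F 2F *ᵗ (m 1F 0F *ᵗ m 2F 1F +ᵗ -ᵗ (m 1F 1F *ᵗ m 2F 0F))

  Σᵗ : ∀ {n} → (Fin n → Term X) → Term X
  Σᵗ {zero}  f = 0ᵗ
  Σᵗ {suc n} f = f zero +ᵗ Σᵗ (f ∘ suc)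

  sumᵗ : List (Term X) → Term X
  sumᵗ []       = 0ᵗ
  sumᵗ (t ∷ ts) = t +ᵗ sumᵗ ts

minorᵗ : Matrix → Fin 5 → Fin 4 → Fin 4 → Term Atom
minorᵗ m i r s = atom (m [ punchIn i r , punchIn i s ])

pfaffianᵗ : Fin 5 → Term Atom
pfaffianᵗ i = sgnᵗ (suc (toℕ i)) (pf4ᵗ (minorᵗ Φ i))

∂pfaffianᵗ : Fin 3 → Fin 5 → Term Atom
∂pfaffianᵗ k i = sgnᵗ (suc (toℕ i)) (∂pf4ᵗ (minorᵗ Φ i) (minorᵗ (∂Φ k) i))

jacobianᵗ : Term Atom
jacobianᵗ = det3ᵗ (λ r s → ∂pfaffianᵗ r (s ↑ˡ 2))

rhsᵗ : Term Atom
rhsᵗ = atom (Φ [ 3F , 4F ]) *ᵗ Σᵗ (λ i → Σᵗ (λ j → ∂pfaffianᵗ 0F i *ᵗ atom (∂Φ 1F [ i , j ]) *ᵗ ∂pfaffianᵗ 2F j))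

mon⁺ mon⁻ : (a b c d e f g h : Fin 5) → Term Atom
mon⁺ a b c d e f g h = atom (Φ [ a , b ]) *ᵗ atom (∂Φ 0F [ c , d ]) *ᵗ atom (∂Φ 1F [ e , f ]) *ᵗ atom (∂Φ 2F [ g , h ])
mon⁻ a b c d e f g h = -ᵗ mon⁺ a b c d e f g h

-- Found by computer algebra; only their correctness is checked, by jacobian-normalForm.
cofactor : Fin 5 → Term Atom
cofactor 0F = sumᵗ
  ( mon⁺ 3F 4F 1F 2F 0F 4F 0F 3F ∷ mon⁻ 3F 4F 1F 2F 0F 3F 0F 4F ∷ mon⁺ 3F 4F 0F 4F 0F 3F 1F 2F ∷ mon⁻ 3F 4F 0F 3F 0F 4F 1F 2F
  ∷ mon⁻ 3F 4F 0F 4F 1F 3F 0F 2F ∷ mon⁺ 3F 4F 0F 3F 1F 4F 0F 2F ∷ mon⁺ 3F 4F 0F 2F 1F 3F 0F 4F ∷ mon⁻ 3F 4F 0F 2F 1F 4F 0F 3F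
  ∷ mon⁺ 3F 4F 0F 4F 2F 3F 0F 1F ∷ mon⁻ 3F 4F 0F 3F 2F 4F 0F 1F ∷ mon⁺ 3F 4F 0F 2F 3F 4F 0F 1F ∷ mon⁻ 3F 4F 0F 1F 2F 3F 0F 4F
  ∷ mon⁺ 3F 4F 0F 1F 2F 4F 0F 3F ∷ mon⁻ 3F 4F 0F 1F 3F 4F 0F 2F ∷ mon⁻ 2F 4F 1F 3F 0F 4F 0F 3F ∷ mon⁺ 2F 4F 0F 4F 1F 3F 0F 3F
  ∷ mon⁺ 2F 4F 1F 3F 0F 3F 0F 4F ∷ mon⁻ 2F 4F 0F 4F 0F 3F 1F 3F ∷ mon⁻ 2F 4F 0F 3F 1F 3F 0F 4F ∷ mon⁺ 2F 4F 0F 3F 0F 4F 1F 3F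
  ∷ mon⁺ 2F 3F 1F 4F 0F 4F 0F 3F ∷ mon⁻ 2F 3F 0F 4F 1F 4F 0F 3F ∷ mon⁻ 2F 3F 1F 4F 0F 3F 0F 4F ∷ mon⁺ 2F 3F 0F 4F 0F 3F 1F 4F
  ∷ mon⁺ 2F 3F 0F 3F 1F 4F 0F 4F ∷ mon⁻ 2F 3F 0F 3F 0F 4F 1F 4F ∷ mon⁺ 1F 4F 2F 3F 0F 4F 0F 3F ∷ mon⁻ 1F 4F 0F 4F 2F 3F 0F 3F
  ∷ mon⁻ 1F 4F 2F 3F 0F 3F 0F 4F ∷ mon⁺ 1F 4F 0F 4F 0F 3F 2F 3F ∷ mon⁺ 1F 4F 0F 3F 2F 3F 0F 4F ∷ mon⁻ 1F 4F 0F 3F 0F 4F 2F 3F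
  ∷ mon⁻ 1F 3F 2F 4F 0F 4F 0F 3F ∷ mon⁺ 1F 3F 0F 4F 2F 4F 0F 3F ∷ mon⁺ 1F 3F 2F 4F 0F 3F 0F 4F ∷ mon⁻ 1F 3F 0F 4F 0F 3F 2F 4F
  ∷ mon⁻ 1F 3F 0F 3F 2F 4F 0F 4F ∷ mon⁺ 1F 3F 0F 3F 0F 4F 2F 4F ∷ mon⁺ 1F 2F 3F 4F 0F 4F 0F 3F ∷ mon⁻ 1F 2F 0F 4F 3F 4F 0F 3F
  ∷ mon⁻ 1F 2F 3F 4F 0F 3F 0F 4F ∷ mon⁺ 1F 2F 0F 4F 0F 3F 3F 4F ∷ mon⁺ 1F 2F 0F 3F 3F 4F 0F 4F ∷ mon⁻ 1F 2F 0F 3F 0F 4F 3F 4F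
  ∷ mon⁺ 0F 4F 2F 3F 1F 3F 0F 4F ∷ mon⁻ 0F 4F 1F 3F 2F 3F 0F 4F ∷ mon⁺ 0F 4F 0F 4F 2F 3F 1F 3F ∷ mon⁻ 0F 4F 0F 4F 1F 3F 2F 3F
  ∷ mon⁻ 0F 4F 2F 3F 1F 4F 0F 3F ∷ mon⁺ 0F 4F 1F 3F 2F 4F 0F 3F ∷ mon⁻ 0F 4F 1F 2F 3F 4F 0F 3F ∷ mon⁻ 0F 4F 3F 4F 0F 3F 1F 2F
  ∷ mon⁺ 0F 4F 1F 2F 0F 3F 3F 4F ∷ mon⁺ 0F 4F 0F 3F 1F 4F 2F 3F ∷ mon⁻ 0F 4F 0F 3F 2F 4F 1F 3F ∷ mon⁺ 0F 4F 0F 3F 3F 4F 1F 2F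
  ∷ mon⁺ 0F 4F 3F 4F 1F 3F 0F 2F ∷ mon⁻ 0F 4F 1F 3F 3F 4F 0F 2F ∷ mon⁺ 0F 4F 0F 2F 3F 4F 1F 3F ∷ mon⁻ 0F 4F 0F 2F 1F 3F 3F 4F
  ∷ mon⁻ 0F 4F 3F 4F 2F 3F 0F 1F ∷ mon⁺ 0F 4F 2F 3F 3F 4F 0F 1F ∷ mon⁻ 0F 4F 0F 1F 3F 4F 2F 3F ∷ mon⁺ 0F 4F 0F 1F 2F 3F 3F 4F
  ∷ mon⁺ 0F 3F 1F 4F 2F 3F 0F 4F ∷ mon⁻ 0F 3F 2F 4F 1F 3F 0F 4F ∷ mon⁺ 0F 3F 1F 2F 3F 4F 0F 4F ∷ mon⁺ 0F 3F 3F 4F 0F 4F 1F 2F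
  ∷ mon⁻ 0F 3F 1F 2F 0F 4F 3F 4F ∷ mon⁻ 0F 3F 0F 4F 2F 3F 1F 4F ∷ mon⁺ 0F 3F 0F 4F 1F 3F 2F 4F ∷ mon⁻ 0F 3F 0F 4F 3F 4F 1F 2F
  ∷ mon⁺ 0F 3F 2F 4F 1F 4F 0F 3F ∷ mon⁻ 0F 3F 1F 4F 2F 4F 0F 3F ∷ mon⁺ 0F 3F 0F 3F 2F 4F 1F 4F ∷ mon⁻ 0F 3F 0F 3F 1F 4F 2F 4F
  ∷ mon⁻ 0F 3F 3F 4F 1F 4F 0F 2F ∷ mon⁺ 0F 3F 1F 4F 3F 4F 0F 2F ∷ mon⁻ 0F 3F 0F 2F 3F 4F 1F 4F ∷ mon⁺ 0F 3F 0F 2F 1F 4F 3F 4F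
  ∷ mon⁺ 0F 3F 3F 4F 2F 4F 0F 1F ∷ mon⁻ 0F 3F 2F 4F 3F 4F 0F 1F ∷ mon⁺ 0F 3F 0F 1F 3F 4F 2F 4F ∷ mon⁻ 0F 3F 0F 1F 2F 4F 3F 4F
  ∷ mon⁺ 0F 2F 3F 4F 1F 3F 0F 4F ∷ mon⁻ 0F 2F 1F 3F 3F 4F 0F 4F ∷ mon⁻ 0F 2F 3F 4F 0F 4F 1F 3F ∷ mon⁺ 0F 2F 1F 3F 0F 4F 3F 4F
  ∷ mon⁺ 0F 2F 0F 4F 3F 4F 1F 3F ∷ mon⁻ 0F 2F 0F 4F 1F 3F 3F 4F ∷ mon⁻ 0F 1F 3F 4F 2F 3F 0F 4F ∷ mon⁺ 0F 1F 2F 3F 3F 4F 0F 4F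
  ∷ mon⁺ 0F 1F 3F 4F 0F 4F 2F 3F ∷ mon⁻ 0F 1F 2F 3F 0F 4F 3F 4F ∷ mon⁻ 0F 1F 0F 4F 3F 4F 2F 3F ∷ mon⁺ 0F 1F 0F 4F 2F 3F 3F 4F
  ∷ [])
cofactor 1F = sumᵗ
  ( mon⁻ 3F 4F 1F 3F 0F 4F 1F 2F ∷ mon⁺ 3F 4F 1F 2F 0F 4F 1F 3F ∷ mon⁺ 3F 4F 1F 4F 0F 3F 1F 2F ∷ mon⁻ 3F 4F 1F 2F 0F 3F 1F 4F
  ∷ mon⁻ 3F 4F 1F 4F 1F 3F 0F 2F ∷ mon⁺ 3F 4F 1F 3F 1F 4F 0F 2F ∷ mon⁻ 3F 4F 0F 2F 1F 4F 1F 3F ∷ mon⁺ 3F 4F 0F 2F 1F 3F 1F 4F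
  ∷ mon⁺ 3F 4F 1F 4F 2F 3F 0F 1F ∷ mon⁻ 3F 4F 1F 3F 2F 4F 0F 1F ∷ mon⁺ 3F 4F 1F 2F 3F 4F 0F 1F ∷ mon⁻ 3F 4F 0F 1F 2F 3F 1F 4F
  ∷ mon⁺ 3F 4F 0F 1F 2F 4F 1F 3F ∷ mon⁻ 3F 4F 0F 1F 3F 4F 1F 2F ∷ mon⁺ 2F 4F 1F 4F 1F 3F 0F 3F ∷ mon⁻ 2F 4F 1F 3F 1F 4F 0F 3F
  ∷ mon⁻ 2F 4F 1F 4F 0F 3F 1F 3F ∷ mon⁺ 2F 4F 1F 3F 0F 3F 1F 4F ∷ mon⁺ 2F 4F 0F 3F 1F 4F 1F 3F ∷ mon⁻ 2F 4F 0F 3F 1F 3F 1F 4F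
  ∷ mon⁻ 2F 3F 1F 4F 1F 3F 0F 4F ∷ mon⁺ 2F 3F 1F 3F 1F 4F 0F 4F ∷ mon⁺ 2F 3F 1F 4F 0F 4F 1F 3F ∷ mon⁻ 2F 3F 1F 3F 0F 4F 1F 4F
  ∷ mon⁻ 2F 3F 0F 4F 1F 4F 1F 3F ∷ mon⁺ 2F 3F 0F 4F 1F 3F 1F 4F ∷ mon⁺ 1F 4F 2F 3F 0F 4F 1F 3F ∷ mon⁻ 1F 4F 1F 3F 0F 4F 2F 3F
  ∷ mon⁻ 1F 4F 1F 4F 2F 3F 0F 3F ∷ mon⁺ 1F 4F 1F 3F 2F 4F 0F 3F ∷ mon⁻ 1F 4F 1F 2F 3F 4F 0F 3F ∷ mon⁻ 1F 4F 2F 3F 0F 3F 1F 4F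
  ∷ mon⁺ 1F 4F 1F 4F 0F 3F 2F 3F ∷ mon⁻ 1F 4F 3F 4F 0F 3F 1F 2F ∷ mon⁺ 1F 4F 1F 2F 0F 3F 3F 4F ∷ mon⁺ 1F 4F 0F 3F 2F 3F 1F 4F
  ∷ mon⁻ 1F 4F 0F 3F 2F 4F 1F 3F ∷ mon⁺ 1F 4F 0F 3F 3F 4F 1F 2F ∷ mon⁺ 1F 4F 3F 4F 1F 3F 0F 2F ∷ mon⁻ 1F 4F 1F 3F 3F 4F 0F 2F
  ∷ mon⁺ 1F 4F 0F 2F 3F 4F 1F 3F ∷ mon⁻ 1F 4F 0F 2F 1F 3F 3F 4F ∷ mon⁻ 1F 4F 3F 4F 2F 3F 0F 1F ∷ mon⁺ 1F 4F 2F 3F 3F 4F 0F 1F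
  ∷ mon⁻ 1F 4F 0F 1F 3F 4F 2F 3F ∷ mon⁺ 1F 4F 0F 1F 2F 3F 3F 4F ∷ mon⁺ 1F 3F 1F 4F 2F 3F 0F 4F ∷ mon⁻ 1F 3F 1F 3F 2F 4F 0F 4F
  ∷ mon⁺ 1F 3F 1F 2F 3F 4F 0F 4F ∷ mon⁻ 1F 3F 2F 4F 0F 4F 1F 3F ∷ mon⁺ 1F 3F 1F 3F 0F 4F 2F 4F ∷ mon⁺ 1F 3F 3F 4F 0F 4F 1F 2F
  ∷ mon⁻ 1F 3F 1F 2F 0F 4F 3F 4F ∷ mon⁻ 1F 3F 0F 4F 2F 3F 1F 4F ∷ mon⁺ 1F 3F 0F 4F 2F 4F 1F 3F ∷ mon⁻ 1F 3F 0F 4F 3F 4F 1F 2F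
  ∷ mon⁺ 1F 3F 2F 4F 0F 3F 1F 4F ∷ mon⁻ 1F 3F 1F 4F 0F 3F 2F 4F ∷ mon⁻ 1F 3F 3F 4F 1F 4F 0F 2F ∷ mon⁺ 1F 3F 1F 4F 3F 4F 0F 2F
  ∷ mon⁻ 1F 3F 0F 2F 3F 4F 1F 4F ∷ mon⁺ 1F 3F 0F 2F 1F 4F 3F 4F ∷ mon⁺ 1F 3F 3F 4F 2F 4F 0F 1F ∷ mon⁻ 1F 3F 2F 4F 3F 4F 0F 1F
  ∷ mon⁺ 1F 3F 0F 1F 3F 4F 2F 4F ∷ mon⁻ 1F 3F 0F 1F 2F 4F 3F 4F ∷ mon⁺ 1F 2F 3F 4F 1F 4F 0F 3F ∷ mon⁻ 1F 2F 1F 4F 3F 4F 0F 3F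
  ∷ mon⁻ 1F 2F 3F 4F 0F 3F 1F 4F ∷ mon⁺ 1F 2F 1F 4F 0F 3F 3F 4F ∷ mon⁺ 1F 2F 0F 3F 3F 4F 1F 4F ∷ mon⁻ 1F 2F 0F 3F 1F 4F 3F 4F
  ∷ mon⁻ 0F 4F 2F 3F 1F 4F 1F 3F ∷ mon⁺ 0F 4F 1F 4F 2F 3F 1F 3F ∷ mon⁺ 0F 4F 2F 3F 1F 3F 1F 4F ∷ mon⁻ 0F 4F 1F 4F 1F 3F 2F 3F
  ∷ mon⁻ 0F 4F 1F 3F 2F 3F 1F 4F ∷ mon⁺ 0F 4F 1F 3F 1F 4F 2F 3F ∷ mon⁺ 0F 3F 2F 4F 1F 4F 1F 3F ∷ mon⁻ 0F 3F 1F 4F 2F 4F 1F 3F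
  ∷ mon⁻ 0F 3F 2F 4F 1F 3F 1F 4F ∷ mon⁺ 0F 3F 1F 4F 1F 3F 2F 4F ∷ mon⁺ 0F 3F 1F 3F 2F 4F 1F 4F ∷ mon⁻ 0F 3F 1F 3F 1F 4F 2F 4F
  ∷ mon⁻ 0F 2F 3F 4F 1F 4F 1F 3F ∷ mon⁺ 0F 2F 1F 4F 3F 4F 1F 3F ∷ mon⁺ 0F 2F 3F 4F 1F 3F 1F 4F ∷ mon⁻ 0F 2F 1F 4F 1F 3F 3F 4F
  ∷ mon⁻ 0F 2F 1F 3F 3F 4F 1F 4F ∷ mon⁺ 0F 2F 1F 3F 1F 4F 3F 4F ∷ mon⁻ 0F 1F 3F 4F 2F 3F 1F 4F ∷ mon⁺ 0F 1F 2F 3F 3F 4F 1F 4F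
  ∷ mon⁺ 0F 1F 3F 4F 1F 4F 2F 3F ∷ mon⁻ 0F 1F 2F 3F 1F 4F 3F 4F ∷ mon⁻ 0F 1F 1F 4F 3F 4F 2F 3F ∷ mon⁺ 0F 1F 1F 4F 2F 3F 3F 4F
  ∷ [])
cofactor 2F = sumᵗ
  ( mon⁻ 3F 4F 2F 3F 0F 4F 1F 2F ∷ mon⁺ 3F 4F 1F 2F 0F 4F 2F 3F ∷ mon⁺ 3F 4F 2F 4F 0F 3F 1F 2F ∷ mon⁻ 3F 4F 1F 2F 0F 3F 2F 4F
  ∷ mon⁺ 3F 4F 2F 3F 1F 4F 0F 2F ∷ mon⁻ 3F 4F 2F 4F 1F 3F 0F 2F ∷ mon⁺ 3F 4F 1F 2F 3F 4F 0F 2F ∷ mon⁻ 3F 4F 0F 2F 1F 4F 2F 3F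
  ∷ mon⁺ 3F 4F 0F 2F 1F 3F 2F 4F ∷ mon⁻ 3F 4F 0F 2F 3F 4F 1F 2F ∷ mon⁺ 3F 4F 2F 4F 2F 3F 0F 1F ∷ mon⁻ 3F 4F 2F 3F 2F 4F 0F 1F
  ∷ mon⁺ 3F 4F 0F 1F 2F 4F 2F 3F ∷ mon⁻ 3F 4F 0F 1F 2F 3F 2F 4F ∷ mon⁺ 2F 4F 2F 3F 0F 4F 1F 3F ∷ mon⁻ 2F 4F 1F 3F 0F 4F 2F 3F
  ∷ mon⁻ 2F 4F 2F 3F 1F 4F 0F 3F ∷ mon⁺ 2F 4F 2F 4F 1F 3F 0F 3F ∷ mon⁻ 2F 4F 1F 2F 3F 4F 0F 3F ∷ mon⁻ 2F 4F 2F 4F 0F 3F 1F 3F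
  ∷ mon⁺ 2F 4F 1F 3F 0F 3F 2F 4F ∷ mon⁻ 2F 4F 3F 4F 0F 3F 1F 2F ∷ mon⁺ 2F 4F 1F 2F 0F 3F 3F 4F ∷ mon⁺ 2F 4F 0F 3F 1F 4F 2F 3F
  ∷ mon⁻ 2F 4F 0F 3F 1F 3F 2F 4F ∷ mon⁺ 2F 4F 0F 3F 3F 4F 1F 2F ∷ mon⁺ 2F 4F 3F 4F 1F 3F 0F 2F ∷ mon⁻ 2F 4F 1F 3F 3F 4F 0F 2F
  ∷ mon⁺ 2F 4F 0F 2F 3F 4F 1F 3F ∷ mon⁻ 2F 4F 0F 2F 1F 3F 3F 4F ∷ mon⁻ 2F 4F 3F 4F 2F 3F 0F 1F ∷ mon⁺ 2F 4F 2F 3F 3F 4F 0F 1F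
  ∷ mon⁻ 2F 4F 0F 1F 3F 4F 2F 3F ∷ mon⁺ 2F 4F 0F 1F 2F 3F 3F 4F ∷ mon⁺ 2F 3F 2F 3F 1F 4F 0F 4F ∷ mon⁻ 2F 3F 2F 4F 1F 3F 0F 4F
  ∷ mon⁺ 2F 3F 1F 2F 3F 4F 0F 4F ∷ mon⁻ 2F 3F 2F 3F 0F 4F 1F 4F ∷ mon⁺ 2F 3F 1F 4F 0F 4F 2F 3F ∷ mon⁺ 2F 3F 3F 4F 0F 4F 1F 2F
  ∷ mon⁻ 2F 3F 1F 2F 0F 4F 3F 4F ∷ mon⁻ 2F 3F 0F 4F 1F 4F 2F 3F ∷ mon⁺ 2F 3F 0F 4F 1F 3F 2F 4F ∷ mon⁻ 2F 3F 0F 4F 3F 4F 1F 2F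
  ∷ mon⁺ 2F 3F 2F 4F 0F 3F 1F 4F ∷ mon⁻ 2F 3F 1F 4F 0F 3F 2F 4F ∷ mon⁻ 2F 3F 3F 4F 1F 4F 0F 2F ∷ mon⁺ 2F 3F 1F 4F 3F 4F 0F 2F
  ∷ mon⁻ 2F 3F 0F 2F 3F 4F 1F 4F ∷ mon⁺ 2F 3F 0F 2F 1F 4F 3F 4F ∷ mon⁺ 2F 3F 3F 4F 2F 4F 0F 1F ∷ mon⁻ 2F 3F 2F 4F 3F 4F 0F 1F
  ∷ mon⁺ 2F 3F 0F 1F 3F 4F 2F 4F ∷ mon⁻ 2F 3F 0F 1F 2F 4F 3F 4F ∷ mon⁻ 1F 4F 2F 4F 2F 3F 0F 3F ∷ mon⁺ 1F 4F 2F 3F 2F 4F 0F 3F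
  ∷ mon⁺ 1F 4F 2F 4F 0F 3F 2F 3F ∷ mon⁻ 1F 4F 2F 3F 0F 3F 2F 4F ∷ mon⁻ 1F 4F 0F 3F 2F 4F 2F 3F ∷ mon⁺ 1F 4F 0F 3F 2F 3F 2F 4F
  ∷ mon⁺ 1F 3F 2F 4F 2F 3F 0F 4F ∷ mon⁻ 1F 3F 2F 3F 2F 4F 0F 4F ∷ mon⁻ 1F 3F 2F 4F 0F 4F 2F 3F ∷ mon⁺ 1F 3F 2F 3F 0F 4F 2F 4F
  ∷ mon⁺ 1F 3F 0F 4F 2F 4F 2F 3F ∷ mon⁻ 1F 3F 0F 4F 2F 3F 2F 4F ∷ mon⁺ 1F 2F 3F 4F 2F 4F 0F 3F ∷ mon⁻ 1F 2F 2F 4F 3F 4F 0F 3F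
  ∷ mon⁻ 1F 2F 3F 4F 0F 3F 2F 4F ∷ mon⁺ 1F 2F 2F 4F 0F 3F 3F 4F ∷ mon⁺ 1F 2F 0F 3F 3F 4F 2F 4F ∷ mon⁻ 1F 2F 0F 3F 2F 4F 3F 4F
  ∷ mon⁺ 0F 4F 2F 4F 2F 3F 1F 3F ∷ mon⁻ 0F 4F 2F 3F 2F 4F 1F 3F ∷ mon⁻ 0F 4F 2F 4F 1F 3F 2F 3F ∷ mon⁺ 0F 4F 2F 3F 1F 3F 2F 4F
  ∷ mon⁺ 0F 4F 1F 3F 2F 4F 2F 3F ∷ mon⁻ 0F 4F 1F 3F 2F 3F 2F 4F ∷ mon⁻ 0F 3F 2F 4F 2F 3F 1F 4F ∷ mon⁺ 0F 3F 2F 3F 2F 4F 1F 4F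
  ∷ mon⁺ 0F 3F 2F 4F 1F 4F 2F 3F ∷ mon⁻ 0F 3F 2F 3F 1F 4F 2F 4F ∷ mon⁻ 0F 3F 1F 4F 2F 4F 2F 3F ∷ mon⁺ 0F 3F 1F 4F 2F 3F 2F 4F
  ∷ mon⁻ 0F 2F 3F 4F 2F 4F 1F 3F ∷ mon⁺ 0F 2F 2F 4F 3F 4F 1F 3F ∷ mon⁺ 0F 2F 3F 4F 1F 3F 2F 4F ∷ mon⁻ 0F 2F 2F 4F 1F 3F 3F 4F
  ∷ mon⁻ 0F 2F 1F 3F 3F 4F 2F 4F ∷ mon⁺ 0F 2F 1F 3F 2F 4F 3F 4F ∷ mon⁺ 0F 1F 3F 4F 2F 4F 2F 3F ∷ mon⁻ 0F 1F 2F 4F 3F 4F 2F 3F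
  ∷ mon⁻ 0F 1F 3F 4F 2F 3F 2F 4F ∷ mon⁺ 0F 1F 2F 4F 2F 3F 3F 4F ∷ mon⁺ 0F 1F 2F 3F 3F 4F 2F 4F ∷ mon⁻ 0F 1F 2F 3F 2F 4F 3F 4F
  ∷ [])
cofactor 3F = sumᵗ
  ( mon⁺ 2F 4F 3F 4F 1F 3F 0F 3F ∷ mon⁻ 2F 4F 1F 3F 3F 4F 0F 3F ∷ mon⁻ 2F 4F 3F 4F 0F 3F 1F 3F ∷ mon⁺ 2F 4F 1F 3F 0F 3F 3F 4F
  ∷ mon⁺ 2F 4F 0F 3F 3F 4F 1F 3F ∷ mon⁻ 2F 4F 0F 3F 1F 3F 3F 4F ∷ mon⁻ 2F 3F 3F 4F 1F 3F 0F 4F ∷ mon⁺ 2F 3F 1F 3F 3F 4F 0F 4F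
  ∷ mon⁺ 2F 3F 3F 4F 0F 4F 1F 3F ∷ mon⁻ 2F 3F 1F 3F 0F 4F 3F 4F ∷ mon⁻ 2F 3F 0F 4F 3F 4F 1F 3F ∷ mon⁺ 2F 3F 0F 4F 1F 3F 3F 4F
  ∷ mon⁻ 2F 3F 3F 4F 1F 4F 0F 3F ∷ mon⁺ 2F 3F 1F 4F 3F 4F 0F 3F ∷ mon⁺ 2F 3F 3F 4F 0F 3F 1F 4F ∷ mon⁻ 2F 3F 1F 4F 0F 3F 3F 4F
  ∷ mon⁻ 2F 3F 0F 3F 3F 4F 1F 4F ∷ mon⁺ 2F 3F 0F 3F 1F 4F 3F 4F ∷ mon⁻ 1F 4F 3F 4F 2F 3F 0F 3F ∷ mon⁺ 1F 4F 2F 3F 3F 4F 0F 3F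
  ∷ mon⁺ 1F 4F 3F 4F 0F 3F 2F 3F ∷ mon⁻ 1F 4F 2F 3F 0F 3F 3F 4F ∷ mon⁻ 1F 4F 0F 3F 3F 4F 2F 3F ∷ mon⁺ 1F 4F 0F 3F 2F 3F 3F 4F
  ∷ mon⁺ 1F 3F 3F 4F 2F 3F 0F 4F ∷ mon⁻ 1F 3F 2F 3F 3F 4F 0F 4F ∷ mon⁻ 1F 3F 3F 4F 0F 4F 2F 3F ∷ mon⁺ 1F 3F 2F 3F 0F 4F 3F 4F
  ∷ mon⁺ 1F 3F 0F 4F 3F 4F 2F 3F ∷ mon⁻ 1F 3F 0F 4F 2F 3F 3F 4F ∷ mon⁺ 1F 3F 3F 4F 2F 4F 0F 3F ∷ mon⁻ 1F 3F 2F 4F 3F 4F 0F 3F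
  ∷ mon⁻ 1F 3F 3F 4F 0F 3F 2F 4F ∷ mon⁺ 1F 3F 2F 4F 0F 3F 3F 4F ∷ mon⁺ 1F 3F 0F 3F 3F 4F 2F 4F ∷ mon⁻ 1F 3F 0F 3F 2F 4F 3F 4F
  ∷ mon⁺ 0F 4F 3F 4F 2F 3F 1F 3F ∷ mon⁻ 0F 4F 2F 3F 3F 4F 1F 3F ∷ mon⁻ 0F 4F 3F 4F 1F 3F 2F 3F ∷ mon⁺ 0F 4F 2F 3F 1F 3F 3F 4F
  ∷ mon⁺ 0F 4F 1F 3F 3F 4F 2F 3F ∷ mon⁻ 0F 4F 1F 3F 2F 3F 3F 4F ∷ mon⁻ 0F 3F 3F 4F 2F 3F 1F 4F ∷ mon⁺ 0F 3F 2F 3F 3F 4F 1F 4F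
  ∷ mon⁺ 0F 3F 3F 4F 1F 4F 2F 3F ∷ mon⁻ 0F 3F 2F 3F 1F 4F 3F 4F ∷ mon⁻ 0F 3F 1F 4F 3F 4F 2F 3F ∷ mon⁺ 0F 3F 1F 4F 2F 3F 3F 4F
  ∷ mon⁻ 0F 3F 3F 4F 2F 4F 1F 3F ∷ mon⁺ 0F 3F 2F 4F 3F 4F 1F 3F ∷ mon⁺ 0F 3F 3F 4F 1F 3F 2F 4F ∷ mon⁻ 0F 3F 2F 4F 1F 3F 3F 4F
  ∷ mon⁻ 0F 3F 1F 3F 3F 4F 2F 4F ∷ mon⁺ 0F 3F 1F 3F 2F 4F 3F 4F
  ∷ [])
cofactor 4F = sumᵗ
  ( mon⁻ 2F 3F 3F 4F 1F 4F 0F 4F ∷ mon⁺ 2F 3F 1F 4F 3F 4F 0F 4F ∷ mon⁺ 2F 3F 3F 4F 0F 4F 1F 4F ∷ mon⁻ 2F 3F 1F 4F 0F 4F 3F 4F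
  ∷ mon⁻ 2F 3F 0F 4F 3F 4F 1F 4F ∷ mon⁺ 2F 3F 0F 4F 1F 4F 3F 4F ∷ mon⁺ 1F 3F 3F 4F 2F 4F 0F 4F ∷ mon⁻ 1F 3F 2F 4F 3F 4F 0F 4F
  ∷ mon⁻ 1F 3F 3F 4F 0F 4F 2F 4F ∷ mon⁺ 1F 3F 2F 4F 0F 4F 3F 4F ∷ mon⁺ 1F 3F 0F 4F 3F 4F 2F 4F ∷ mon⁻ 1F 3F 0F 4F 2F 4F 3F 4F
  ∷ mon⁻ 0F 3F 3F 4F 2F 4F 1F 4F ∷ mon⁺ 0F 3F 2F 4F 3F 4F 1F 4F ∷ mon⁺ 0F 3F 3F 4F 1F 4F 2F 4F ∷ mon⁻ 0F 3F 2F 4F 1F 4F 3F 4F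
  ∷ mon⁻ 0F 3F 1F 4F 3F 4F 2F 4F ∷ mon⁺ 0F 3F 1F 4F 2F 4F 3F 4F
  ∷ [])

jacobian-congruenceᵗ : Term Atom
jacobian-congruenceᵗ = rhsᵗ +ᵗ Σᵗ (λ i → cofactor i *ᵗ pfaffianᵗ i)

open Normalisation using (normalForm)

jacobian-normalForm : normalForm ((jacobianᵗ +ᵗ -ᵗ jacobian-congruenceᵗ) >>= upperTriangular >>= atom ∘ atomIndex)
                    ≡ normalForm 0ᵗ
jacobian-normalForm = ≡.refl

module _ {c ℓ} (S : CommutativeRing c ℓ) where
  open CommutativeRing S
  open Evaluation S
  open Alternation S
  open AbelianGroupProperties +-abelianGroup using (x∙y⁻¹≈ε⇒x≈y)
  open SetoidReasoning setoid

  jacobian-congruence : ∀ ρ → Alternating ρ → ⟦ jacobianᵗ ⟧ ρ ≈ ⟦ jacobian-congruenceᵗ ⟧ ρ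
  jacobian-congruence ρ alt = x∙y⁻¹≈ε⇒x≈y _ _ (begin
    ⟦ difference ⟧ ρ                                ≈⟨ ⟦⟧-cong (upperTriangular-sound alt) difference ⟩
    ⟦ difference ⟧ (λ x → ⟦ upperTriangular x ⟧ ρ)  ≡⟨ ⟦⟧->>= difference upperTriangular ρ ⟨
    ⟦ difference >>= upperTriangular ⟧ ρ            ≈⟨ Normalisation.≈0-by-normalForm S atomIndex indexAtom indexAtom-atomIndex
                                                          (difference >>= upperTriangular) jacobian-normalForm ρ ⟩
    0#                                              ∎)
    where
    difference : Term Atom
    difference = jacobianᵗ +ᵗ -ᵗ jacobian-congruenceᵗ

module Specialisation {c ℓ} (R : CommutativeRing c ℓ) (φ : Pol.X5 R) where
  open Pol R
  open Pol.X5 φ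
  open PolynomialRing R
  open CommutativeRing R using () renaming (0# to 0ᴿ)
  open Alternation commutativeRing using (Alternating)

  atomValue : Atom → Poly
  atomValue (Φ    [ i , j ]) = entry φ i j
  atomValue (∂Φ k [ i , j ]) = ∂ (k ↑ˡ 2) (entry φ i j)

  atomValue-alternating : Alternating atomValue
  atomValue-alternating = record { diagonal = diagonal ; antisymmetric = antisymmetric }
    where
    diagonal : ∀ m i → atomValue (m [ i , i ]) ≋ con 0ᴿ
    diagonal Φ      i = linearForm-0 (alt-diag i)
    diagonal (∂Φ k) i = ≋-trans (∂-linearForm _ (coeff i i)) (con-cong (alt-diag i _))

    antisymmetric : ∀ m i j → atomValue (m [ j , i ]) ≋ ⊝ atomValue (m [ i , j ])
    antisymmetric Φ      i j = linearForm-neg (alt-skew i j)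
    antisymmetric (∂Φ k) i j =
      ≋-trans (∂-linearForm _ (coeff j i))
              (≋-trans (≋-trans (con-cong (alt-skew i j _)) (con-- _)) (⊝-cong (≋-sym (∂-linearForm _ (coeff i j)))))

-- jac123 φ, rhs φ and pfaff φ i compute to ⟦ jacobianᵗ ⟧, ⟦ rhsᵗ ⟧ and ⟦ pfaffianᵗ i ⟧ at atomValue.
lemma7p5 : ∀ {c ℓ} (R : CommutativeRing c ℓ) (φ : Pol.X5 R) →
    Pol._≡_mod-Pf_ R (Pol.jac123 R φ) (Pol.rhs R φ) φ
lemma7p5 R φ = (λ i → ⟦ cofactor i ⟧ atomValue) , jacobian-congruence R[x] atomValue atomValue-alternating
  where
  open Specialisation R φ
  R[x] : CommutativeRing _ _
  R[x] = PolynomialRing.commutativeRing R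
  open Evaluation R[x]
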